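{- Let $G$ be a finite graph and $t\ge 0$ an integer. Let $k$ denote the largest clique cover width $CCW(H)$ over all $t$-shallow minors $H$ of $G$, and let $p$ be the largest integer such that some $t$-shallow minor of $G$ is isomorphic to $K_{p,p}$. Then $p\le \hat\beta_t(G)\le k+1$.
   Context: All graphs are finite, simple and undirected. A $t$-shallow minor of $G$ is a graph $H$ obtained from $G$ by choosing pairwise disjoint vertex sets $V_1,\dots,V_m\subseteq V(G)$, each inducing a connected subgraph of radius at most $t$, contracting each $V_i$ to a single vertex $v_i$ and deleting all other vertices; $v_iv_j$ ($i\neq j$) is an edge of $H$ iff $G$ has an edge between $V_i$ and $V_j$. For a graph $H$, $\beta(H)$ is the minimum number of pairwise disjoint cliques partitioning $V(H)$; for $x\in V(H)$, $H_x$ is the subgraph induced by the closed neighborhood of $x$; $\tilde\beta(H)=\min_{x\in V(H)}\beta(H_x)$; and $\hat\beta_t(G)$ is the maximum of $\tilde\beta(H)$ over all $t$-shallow minors $H$ of $G$. A clique cover of $H$ is a partition $C$ of $V(H)$ into cliques; its clique cover graph is obtained by contracting each clique of $C$ into a single vertex. The clique cover width $CCW(H)$ is the minimum, over all clique covers $C$ of $H$, of the bandwidth of the clique cover graph of $C$. -}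

module Defs where

open import Data.Nat using (ℕ; zero; suc; _≤_; _<_; ∣_-_∣)
open import Data.Fin using (Fin; toℕ)
open import Data.Maybe using (Maybe; just; nothing)
open import Data.Product using (Σ; ∃; ∃-syntax; _×_; _,_)
open import Data.Sum using (_⊎_; inj₁; inj₂)
open import Data.Empty using (⊥)
open import Relation.Nullary using (¬_)
open import Relation.Binary.PropositionalEquality using (_≡_; _≢_; refl)
open import Function.Definitions using (Injective)
open import Function.Bundles using (_⇔_)
open import Data.Nat.Properties using (<⇒≱)

record Graph : Set₁ where
  field
    n      : ℕ
    Adj    : Fin n → Fin n → Set
    sym    : ∀ {u v} → Adj u v → Adj v u
    irrefl : ∀ {u} → ¬ Adj u u
open Graph public

data WalkIn (G : Graph) (P : Fin (n G) → Set) : Fin (n G) → Fin (n G) → ℕ → Set where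
  here : ∀ {u} → P u → WalkIn G P u u zero
  step : ∀ {u w v ℓ} → P u → Adj G u w → WalkIn G P w v ℓ → WalkIn G P u v (suc ℓ)

-- A model of H in G assigns to each vertex of G the
-- branch set it belongs to (or none: deleted); branch sets are thus
-- pairwise disjoint.  Each branch set V_i has a centre c_i ∈ V_i from which
-- every vertex of V_i is reachable by a walk of length ≤ t inside G[V_i]
-- (i.e. G[V_i] is connected of radius ≤ t).  H ≅ the contracted graph,
-- the vertices of H being identified with the indices of the branch sets.

record ShallowMinorModel (t : ℕ) (G H : Graph) : Set where
  field
    branch   : Fin (n G) → Maybe (Fin (n H))
    centre   : Fin (n H) → Fin (n G)
    centre∈  : ∀ i → branch (centre i) ≡ just i
    radius   : ∀ i v → branch v ≡ just i →
               ∃[ ℓ ] (ℓ ≤ t × WalkIn G (λ u → branch u ≡ just i) (centre i) v ℓ)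
    adjacent : ∀ i j → Adj H i j ⇔
               (i ≢ j × ∃[ u ] ∃[ v ] (branch u ≡ just i × branch v ≡ just j × Adj G u v))

IsShallowMinor : ℕ → Graph → Graph → Set
IsShallowMinor t G H = ShallowMinorModel t G H

K : ℕ → Graph
K p = record
  { n = p Data.Nat.+ p
  ; Adj = λ i j → (toℕ i < p × p ≤ toℕ j) ⊎ (p ≤ toℕ i × toℕ j < p)
  ; sym = λ { (inj₁ (a , b)) → inj₂ (b , a) ; (inj₂ (a , b)) → inj₁ (b , a) }
  ; irrefl = λ { (inj₁ (a , b)) → <⇒≱ a b ; (inj₂ (a , b)) → <⇒≱ b a }
  }

ClosedNbhd : (H : Graph) → Fin (n H) → Fin (n H) → Set
ClosedNbhd H x v = (v ≡ x) ⊎ Adj H x v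

-- β(H_x) ≤ b : the vertex set of H_x = H[N[x]] can be partitioned into at
-- most b cliques (f assigns each vertex of N[x] to one of b classes, each
-- class being a clique; empty classes are simply not counted).
BetaNbhdAtMost : (H : Graph) → Fin (n H) → ℕ → Set
BetaNbhdAtMost H x b =
  Σ (Fin (n H) → Fin b) λ f →
    ∀ u v → ClosedNbhd H x u → ClosedNbhd H x v → f u ≡ f v → u ≢ v → Adj H u v

-- β̃(H) ≤ b  :  min_x β(H_x) ≤ b
TildeBetaAtMost : Graph → ℕ → Set
TildeBetaAtMost H b = ∃[ x ] BetaNbhdAtMost H x b

-- β̃(H) = b  (least b with β̃(H) ≤ b; only defined when H has a vertex)
IsTildeBeta : Graph → ℕ → Set
IsTildeBeta H b = TildeBetaAtMost H b × (∀ b′ → TildeBetaAtMost H b′ → b ≤ b′)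

-- β̂_t(G) = b : maximum of β̃(H) over all t-shallow minors H of G
-- (over those with at least one vertex, where β̃ is defined).
IsBetaHat : ℕ → Graph → ℕ → Set₁
IsBetaHat t G b =
  (∃[ H ] (IsShallowMinor t G H × 0 < n H × IsTildeBeta H b)) ×
  (∀ H → IsShallowMinor t G H → 0 < n H → TildeBetaAtMost H b)

record CliqueCover (H : Graph) (c : ℕ) : Set where
  field
    cls       : Fin (n H) → Fin c
    surj      : ∀ a → ∃[ v ] (cls v ≡ a)
    clique    : ∀ u v → cls u ≡ cls v → u ≢ v → Adj H u v

coverGraph : (H : Graph) {c : ℕ} → CliqueCover H c → Graph
coverGraph H {c} C = record
  { n = c
  ; Adj = λ a b → a ≢ b × ∃[ u ] ∃[ v ] (cls u ≡ a × cls v ≡ b × Adj H u v)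
  ; sym = λ { (a≢b , u , v , p , q , e) → (λ eq → a≢b (sym≡ eq)) , v , u , q , p , Graph.sym H e }
  ; irrefl = λ { (a≢a , _) → a≢a refl }
  }
  where open CliqueCover C
        sym≡ : ∀ {A : Set} {x y : A} → x ≡ y → y ≡ x
        sym≡ refl = refl

BandwidthAtMost : Graph → ℕ → Set
BandwidthAtMost Q w =
  Σ (Fin (n Q) → Fin (n Q)) λ π → Injective _≡_ _≡_ π ×
    (∀ a b → Adj Q a b → ∣ toℕ (π a) - toℕ (π b) ∣ ≤ w)

CCWAtMost : Graph → ℕ → Set
CCWAtMost H w = ∃[ c ] Σ (CliqueCover H c) λ C → BandwidthAtMost (coverGraph H C) w

IsCCW : Graph → ℕ → Set
IsCCW H w = CCWAtMost H w × (∀ w′ → CCWAtMost H w′ → w ≤ w′)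

IsMaxCCW : ℕ → Graph → ℕ → Set₁
IsMaxCCW t G k =
  (∃[ H ] (IsShallowMinor t G H × IsCCW H k)) ×
  (∀ H → IsShallowMinor t G H → CCWAtMost H k)

-- p = largest integer such that some t-shallow minor of G is isomorphic
-- to K_{p,p}  (the minor relation is already up to relabelling of H)
IsMaxKpp : ℕ → Graph → ℕ → Set
IsMaxKpp t G p = IsShallowMinor t G (K p) × (∀ q → IsShallowMinor t G (K q) → q ≤ p)

-- In K_{p,p} the closed neighbourhood of any vertex contains the whole
-- opposite side, an independent set of size p; no two of its vertices can
-- share a clique, so β̃(K_{p,p}) ≥ p, and K_{p,p} is a t-shallow minor.
-- Conversely, take a clique cover of a minor H whose cover graph has a
-- layout of bandwidth ≤ k, and let x lie in the leftmost clique.  Every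
-- neighbour of x lies in one of the k + 1 cliques at positions
-- π(x), …, π(x) + k, so N[x] is covered by k + 1 cliques and β̃(H) ≤ k + 1.
module Submission where

open import Defs
open import Data.Nat using (ℕ; _≤_; _+_)
open import Data.Product using (_×_)

open import Data.Nat using (zero; suc; _<_; _<?_; _∸_; z≤n; s≤s; ∣_-_∣)
open import Data.Nat.Properties
  using (m≤m+n; <⇒≱; ≮⇒≥; +-comm; ∣n-n∣≡0; m≤n⇒∣m-n∣≡n∸m; ∸-cancelʳ-≡)
open import Data.Nat.DivMod using (_mod_; m<n⇒m%n≡m)
open import Data.Fin using (Fin; toℕ; _↑ˡ_; _↑ʳ_; _≟_)
open import Data.Fin.Properties
  using (toℕ-injective; toℕ-fromℕ<; toℕ<n; toℕ-↑ˡ; toℕ-↑ʳ; ↑ˡ-injective; ↑ʳ-injective; injective⇒≤)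
open import Data.List using (allFin)
open import Data.List.Extrema.Nat using (argmin; f[argmin]≤f[xs])
open import Data.List.Membership.Propositional.Properties using (∈-allFin)
open import Data.List.Relation.Unary.All as All using ()
open import Data.Product using (∃-syntax; _,_; proj₁; proj₂)
open import Data.Sum using (inj₁; inj₂)
open import Data.Empty using (⊥-elim)
open import Relation.Nullary using (¬_; yes; no)
open import Relation.Binary.PropositionalEquality
  using (_≡_; _≢_; refl; cong; subst; trans; module ≡-Reasoning)
  renaming (sym to ≡-sym)
open import Function.Definitions using (Injective)

Independent : (H : Graph) {m : ℕ} → (Fin m → Fin (n H)) → Set
Independent H e = ∀ i j → ¬ Adj H (e i) (e j)

independent-nbhd⇒≤β :
  ∀ {H x b m} (e : Fin m → Fin (n H)) → Injective _≡_ _≡_ e → Independent H e →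
  (∀ i → ClosedNbhd H x (e i)) → BetaNbhdAtMost H x b → m ≤ b
independent-nbhd⇒≤β e e-inj indep e∈N[x] (f , classes-cliques) = injective⇒≤ f∘e-inj
  where
  f∘e-inj : ∀ {i j} → f (e i) ≡ f (e j) → i ≡ j
  f∘e-inj {i} {j} same-class with i ≟ j
  ... | yes i≡j = i≡j
  ... | no i≢j = ⊥-elim (indep i j
          (classes-cliques (e i) (e j) (e∈N[x] i) (e∈N[x] j) same-class (λ eq → i≢j (e-inj eq))))

module _ (p : ℕ) where

  left right : Fin p → Fin (n (K p))
  left i = i ↑ˡ p
  right i = p ↑ʳ i

  left< : ∀ i → toℕ (left i) < p
  left< i = subst (_< p) (≡-sym (toℕ-↑ˡ i p)) (toℕ<n i)

  right≥ : ∀ i → p ≤ toℕ (right i)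
  right≥ i = subst (p ≤_) (≡-sym (toℕ-↑ʳ p i)) (m≤m+n p (toℕ i))

  left-independent : Independent (K p) left
  left-independent i j (inj₁ (_ , p≤j)) = <⇒≱ (left< j) p≤j
  left-independent i j (inj₂ (p≤i , _)) = <⇒≱ (left< i) p≤i

  right-independent : Independent (K p) right
  right-independent i j (inj₁ (i<p , _)) = <⇒≱ i<p (right≥ i)
  right-independent i j (inj₂ (_ , j<p)) = <⇒≱ j<p (right≥ j)

  K-tildeBeta≥ : ∀ {b} → TildeBetaAtMost (K p) b → p ≤ b
  K-tildeBeta≥ (x , β) with toℕ x <? p
  ... | yes x<p = independent-nbhd⇒≤β {H = K p} right (λ {i} {j} → ↑ʳ-injective p i j) right-independent
                    (λ i → inj₂ (inj₁ (x<p , right≥ i))) β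
  ... | no x≮p = independent-nbhd⇒≤β {H = K p} left (λ {i} {j} → ↑ˡ-injective p i j) left-independent
                   (λ i → inj₂ (inj₂ (≮⇒≥ x≮p , left< i))) β

argmin-Fin : ∀ {N} (g : Fin N → ℕ) → Fin N → ∃[ x ] (∀ u → g x ≤ g u)
argmin-Fin {N} g x₀ = x , λ u → All.lookup (f[argmin]≤f[xs] x₀ (allFin N)) (∈-allFin u)
  where x = argmin g x₀ (allFin N)

-- A labelling whose level sets are cliques, with N[x] inside the window
-- [h x, h x + w], yields a cover of N[x] by w + 1 cliques: u ↦ h u − h x.
window⇒BetaNbhdAtMost :
  ∀ {H x w} (h : Fin (n H) → ℕ) →
  (∀ u v → h u ≡ h v → u ≢ v → Adj H u v) →
  (∀ u → h x ≤ h u) → (∀ u → ClosedNbhd H x u → h u ∸ h x ≤ w) →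
  BetaNbhdAtMost H x (suc w)
window⇒BetaNbhdAtMost {H} {x} {w} h level-cliques h-min window =
  offset , λ u v u∈N v∈N same u≢v → level-cliques u v (same-level u∈N v∈N same) u≢v
  where
  offset : Fin (n H) → Fin (suc w)
  offset u = (h u ∸ h x) mod suc w

  toℕ-offset : ∀ {u} → ClosedNbhd H x u → toℕ (offset u) ≡ h u ∸ h x
  toℕ-offset {u} u∈N = trans (toℕ-fromℕ< _) (m<n⇒m%n≡m (s≤s (window u u∈N)))

  same-level : ∀ {u v} → ClosedNbhd H x u → ClosedNbhd H x v → offset u ≡ offset v → h u ≡ h v
  same-level {u} {v} u∈N v∈N same = ∸-cancelʳ-≡ (h-min u) (h-min v) (begin
    h u ∸ h x        ≡⟨ ≡-sym (toℕ-offset u∈N) ⟩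
    toℕ (offset u)   ≡⟨ cong toℕ same ⟩
    toℕ (offset v)   ≡⟨ toℕ-offset v∈N ⟩
    h v ∸ h x        ∎)
    where open ≡-Reasoning

CCW⇒tildeBeta≤ : ∀ {H k} → 0 < n H → CCWAtMost H k → TildeBetaAtMost H (suc k)
CCW⇒tildeBeta≤ {H} {k} (s≤s z≤n) (_ , C , π , π-inj , bandwidth) =
  x , window⇒BetaNbhdAtMost {H = H} {x = x} position level-cliques x-leftmost
        (λ u u∈N → subst (_≤ k) (m≤n⇒∣m-n∣≡n∸m (x-leftmost u)) (stretch u∈N))
  where
  open CliqueCover C

  position : Fin (n H) → ℕ
  position u = toℕ (π (cls u))

  leftmost : ∃[ x ] (∀ u → position x ≤ position u)
  leftmost = argmin-Fin position Data.Fin.zero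
  x : Fin (n H)
  x = proj₁ leftmost

  x-leftmost : ∀ u → position x ≤ position u
  x-leftmost = proj₂ leftmost

  no-stretch : ∣ position x - position x ∣ ≤ k
  no-stretch = subst (_≤ k) (≡-sym (∣n-n∣≡0 (position x))) z≤n

  level-cliques : ∀ u v → position u ≡ position v → u ≢ v → Adj H u v
  level-cliques u v same = clique u v (π-inj (toℕ-injective same))

  stretch : ∀ {u} → ClosedNbhd H x u → ∣ position x - position u ∣ ≤ k
  stretch (inj₁ refl) = no-stretch
  stretch {u} (inj₂ x~u) with cls x ≟ cls u
  ... | yes same = subst (λ a → ∣ position x - toℕ (π a) ∣ ≤ k) same no-stretch
  ... | no differ = bandwidth (cls x) (cls u) (differ , x , u , refl , refl , x~u)

corollary1 : (G : Graph) (t k p b : ℕ) →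
    IsMaxCCW t G k → IsMaxKpp t G p → IsBetaHat t G b →
    p ≤ b × b ≤ k + 1
corollary1 G t k p b (_ , minors-CCW≤k) (Kpp-minor , _)
           ((H , H-minor , H-nonempty , _ , b-least) , minors-tildeBeta≤b) =
  p≤b p Kpp-minor , b≤k+1
  where
  p≤b : ∀ q → IsShallowMinor t G (K q) → q ≤ b
  p≤b zero _ = z≤n
  p≤b (suc q) minor = K-tildeBeta≥ (suc q) (minors-tildeBeta≤b (K (suc q)) minor (s≤s z≤n))

  b≤k+1 : b ≤ k + 1
  b≤k+1 = subst (b ≤_) (+-comm 1 k)
            (b-least (suc k) (CCW⇒tildeBeta≤ H-nonempty (minors-CCW≤k H H-minor)))
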